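{- Let $(G,k,F,T,w)$ be an ELSS instance and let $P$ be a path in $G$ with $\deg_G(v) = 2$ for all $v \in V(P)$ and $N_G(V(P)) = \{a,b\}$ for some $a,b \in F$. Let $\mathfrak{X}$ be a set of descriptions for $G-V(P)$ such that $\mathcal{T}_{G-V(P)}(\mathfrak{X}) = \max_w(\mathcal{S}_{G-V(P)}^{k-1}(F \setminus V(P)))$. Then for all $p \in V(P) \setminus F$, $$\mathcal{T}_G\big(\{(r, \mathcal{X} \cup \{\{p\}\}) \mid (r,\mathcal{X}) \in \mathfrak{X}\}\big) = \max_w \{H \in \mathcal{S}_G^{k}(F) \mid p \in N_G(H)\}.$$
   Context: Graphs are simple and undirected; $N_G(S)$ is the open neighborhood of $S\subseteq V(G)$, and for an induced subgraph $H$, $N_G(H) := N_G(V(H))$, $w(H) := \sum_{x \in V(H)} w(x)$. An induced subgraph $H$ is a $k$-secluded tree in $G$ if $H$ is a tree and $|N_G(H)| \le k$. An ELSS instance is a tuple $(G,k,F,T,w)$ with $G$ a graph, $k$ a non-negative integer, non-empty vertex sets $T \subseteq F \subseteq V(G)$ with $G[T]$ connected, and $w \colon V(G) \to \mathbb{N}^+$ (for subgraphs of $G$ the same $w$ is used). $\mathcal{S}_G^{k}(F)$ is the set of all induced subgraphs $H$ of $G$ that are trees with $F \subseteq V(H)$ and $|N_G(H)|\le k$. For a set $Y$ of subgraphs, $\max_w(Y) := \{H \in Y : w(H) \ge w(H') \text{ for all } H' \in Y\}$. A description for a graph $G$ is a pair $(r,\mathcal{X})$ with $r \in V(G)$ and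 $\mathcal{X}$ a set of pairwise disjoint subsets of $V(G)\setminus\{r\}$ such that for every set $S$ containing exactly one vertex from each $X \in \mathcal{X}$, the component $H$ of $G-S$ containing $r$ is acyclic and $N_G(H)=S$; its order is $|\mathcal{X}|$. A $k$-secluded tree $H$ is described by $(r,\mathcal{X})$ if $r\in V(H)$ and $N_G(H)$ consists of exactly one vertex of each $X\in\mathcal{X}$. For a set $\mathfrak{X}$ of descriptions of maximum order $k$, $\mathcal{T}_G(\mathfrak{X})$ is the set of $k$-secluded trees in $G$ described by some description in $\mathfrak{X}$. -}

module Defs where

open import Data.Nat using (ℕ; zero; suc; _+_; _≤_)
open import Data.Bool using (Bool; true; false; _∧_; _∨_; not; if_then_else_)
open import Data.Fin using (Fin; zero; suc)
open import Data.Fin.Properties using (_≟_)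
open import Data.Vec using (Vec; []; _∷_; lookup; tabulate)
open import Data.List using (List; []; _∷_; _++_; length; map)
open import Data.List.Relation.Unary.All using (All)
open import Data.List.Relation.Unary.Any using (Any)
open import Data.List.Relation.Unary.AllPairs using (AllPairs)
open import Data.List.Relation.Unary.Unique.Propositional using (Unique)
open import Data.Product using (Σ; ∃; _×_; _,_)
open import Data.Unit using () renaming (⊤ to Unit)
open import Relation.Nullary using (¬_; does)
open import Relation.Binary.PropositionalEquality using (_≡_)
open import Function.Bundles using (_⇔_)
open import Data.Fin.Subset public
  using (Subset; _∈_; _∉_; _⊆_; ∁; _∩_; _∪_; _─_; ⁅_⁆; ∣_∣; Nonempty; Empty)
  renaming (⊤ to Full; ⊥ to ∅)

record Graph (n : ℕ) : Set where
  field
    adj    : Fin n → Fin n → Bool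
    sym    : ∀ u v → adj u v ≡ adj v u
    irrefl : ∀ v → adj v v ≡ false
open Graph public

module _ {n : ℕ} (G : Graph n) where

  Adj : Fin n → Fin n → Set
  Adj u v = adj G u v ≡ true

  private
    anyV : ∀ {m} → (Fin m → Bool) → Bool
    anyV {zero}  f = false
    anyV {suc m} f = f zero ∨ anyV (λ i → f (suc i))

  -- open neighbourhood of S in the induced subgraph G[U]:
  -- the vertices of U ∖ S adjacent to some vertex of S.
  N : (U S : Subset n) → Subset n
  N U S = tabulate λ v →
    lookup U v ∧ not (lookup S v) ∧ anyV (λ u → lookup S u ∧ adj G u v)

  deg : Fin n → ℕ
  deg v = ∣ tabulate (adj G v) ∣

  AdjChain : List (Fin n) → Set
  AdjChain []           = Unit
  AdjChain (x ∷ [])     = Unit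
  AdjChain (x ∷ y ∷ xs) = Adj x y × AdjChain (y ∷ xs)

  data Reach (C : Subset n) : Fin n → Fin n → Set where
    here : ∀ {u} → u ∈ C → Reach C u u
    step : ∀ {u v w} → u ∈ C → Adj u v → Reach C v w → Reach C u w

  Connected : Subset n → Set
  Connected C = ∀ u v → u ∈ C → v ∈ C → Reach C u v

  IsCycle : Subset n → Fin n → List (Fin n) → Set
  IsCycle C x xs =
    2 ≤ length xs × Unique (x ∷ xs) × All (_∈ C) (x ∷ xs) × AdjChain (x ∷ xs ++ x ∷ [])

  Acyclic : Subset n → Set
  Acyclic C = ∀ x xs → ¬ IsCycle C x xs

  Tree : Subset n → Set
  Tree C = Nonempty C × Connected C × Acyclic C

  toSubset : List (Fin n) → Subset n
  toSubset []       = ∅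
  toSubset (x ∷ xs) = ⁅ x ⁆ ∪ toSubset xs

  IsPath : List (Fin n) → Set
  IsPath ps = ¬ (ps ≡ []) × Unique ps × AdjChain ps

  IsComponent : (W : Subset n) → Fin n → Subset n → Set
  IsComponent W r C = r ∈ C × C ⊆ W × Connected C × Empty (N W C)

  Transversal : List (Subset n) → Subset n → Set
  Transversal 𝒳 S =
    (∀ {v} → v ∈ S → Any (v ∈_) 𝒳) × All (λ X → ∣ S ∩ X ∣ ≡ 1) 𝒳

  Descr : Set
  Descr = Fin n × List (Subset n)

  IsDescription : Subset n → Descr → Set
  IsDescription U (r , 𝒳) =
    r ∈ U ×
    All (λ X → X ⊆ U × r ∉ X) 𝒳 ×
    AllPairs (λ X Y → Empty (X ∩ Y)) 𝒳 ×
    (∀ S → Transversal 𝒳 S → ∀ C → IsComponent (U ─ S) r C →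
       Acyclic C × N U C ≡ S)

  DescribedBy : Subset n → Descr → Subset n → Set
  DescribedBy U (r , 𝒳) H = r ∈ H × Transversal 𝒳 (N U H)

  SecludedTree : Subset n → ℕ → Subset n → Set
  SecludedTree U k H = H ⊆ U × Tree H × ∣ N U H ∣ ≤ k

  𝒯 : Subset n → ℕ → List Descr → Subset n → Set
  𝒯 U k 𝔛 H = SecludedTree U k H × Any (λ d → DescribedBy U d H) 𝔛

  𝒮 : Subset n → ℕ → Subset n → Subset n → Set
  𝒮 U k F H = SecludedTree U k H × F ⊆ H

  ELSS : ℕ → Subset n → Subset n → (Fin n → ℕ) → Set
  ELSS k F T w = Nonempty T × T ⊆ F × Connected T × (∀ v → 1 ≤ w v)

wt : ∀ {n} → (Fin n → ℕ) → Subset n → ℕ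
wt {zero}  w []       = 0
wt {suc n} w (s ∷ S) = (if s then w zero else 0) + wt (λ i → w (suc i)) S

Max : ∀ {n} → (Fin n → ℕ) → (Subset n → Set) → Subset n → Set
Max w Y H = Y H × (∀ H' → Y H' → wt w H' ≤ wt w H)

_≐_ : ∀ {n} → (Subset n → Set) → (Subset n → Set) → Set
A ≐ B = ∀ H → A H ⇔ B H

-- Let Q be the path without p.  A tree H of G containing F with p ∈ N(H) avoids p,
-- so H ∖ P is a tree of G - P containing F ∖ P with N(H ∖ P) ⊆ N(H) - p.  Conversely,
-- the two halves of Q hang off a and b and all their vertices have degree two, so
-- adding Q to a tree H′ of G - P containing a and b gives a tree of G with
-- N(H′ ∪ Q) = N_{G-P}(H′) ∪ {p}.  Since w(H) ≤ w(H ∖ P) + w(Q), with equality when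
-- Q ⊆ H, the heaviest trees on the two sides correspond, and their descriptions
-- differ exactly by the part {p}.
module Submission where

open import Defs hiding (sym)
open import Data.Bool using (Bool; true; false; _∧_; _∨_; not; if_then_else_)
open import Data.Bool.Properties using (∨-zeroʳ)
open import Data.Empty using (⊥; ⊥-elim)
open import Data.Fin using (Fin; zero; suc)
open import Data.Fin.Properties using (_≟_)
open import Data.Fin.Subset using (_-_)
open import Data.Fin.Subset.Properties
  using (_∈?_; ∈⊤; ⊆⊤; ∉⊥; x∈⁅x⁆; x∈⁅y⁆⇒x≡y; ∣⁅x⁆∣≡1; p─⊥≡p; drop-∷-⊆;
         x∈p∪q⁺; x∈p∪q⁻; x∈p∩q⁺; x∈p∩q⁻; p∩q⊆p; p∩q⊆q; p─q⊆p; ⊆-antisym;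
         x∈∁p⇒x∉p; x∉p⇒x∈∁p; x∈p∧x∉q⇒x∈p─q; x∈p∧x≢y⇒x∈p-y; Empty-unique; x∈p⇒∣p-x∣<∣p∣; p⊆q⇒∣p∣≤∣q∣)
open import Data.List using (List; []; _∷_; _++_; length; map)
open import Data.List.Properties using (++-assoc; ++-identityʳ; length-++)
open import Data.List.Membership.Propositional using (find; lose) renaming (_∈_ to _∈ₗ_)
open import Data.List.Membership.Propositional.Properties using (∈-∃++; ∈-++⁻; ∈-++⁺ˡ; ∈-++⁺ʳ)
open import Data.List.Relation.Unary.All as All using (All; []; _∷_)
import Data.List.Relation.Unary.All.Properties as Allₚ
open import Data.List.Relation.Unary.Any as Any using (Any)
import Data.List.Relation.Unary.Any.Properties as Anyₚ
open import Data.List.Relation.Unary.AllPairs using ([]; _∷_)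
open import Data.List.Relation.Unary.Unique.Propositional using (Unique)
import Data.List.Relation.Unary.Unique.Propositional.Properties as Uniqueₚ
open import Data.Nat using (ℕ; zero; suc; _+_; _∸_; _≤_; _<_; z≤n; s≤s)
import Data.Nat.Properties as ℕₚ
open import Data.Product using (∃; _×_; _,_; proj₁; proj₂)
open import Data.Sum using (_⊎_; inj₁; inj₂; [_,_]′)
open import Data.Unit using (tt)
open import Data.Vec using ([]; _∷_; here; there; lookup; tabulate)
open import Data.Vec.Properties using ([]=⇒lookup; lookup⇒[]=; lookup∘tabulate)
open import Function using (_∘_)
open import Function.Bundles using (mk⇔; Equivalence)
open import Relation.Binary.Definitions using (tri<; tri≈; tri>)
open import Relation.Binary.PropositionalEquality
  using (_≡_; _≢_; refl; sym; trans; cong; cong₂; subst; module ≡-Reasoning)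
open import Algebra.Properties.CommutativeSemigroup ℕₚ.+-commutativeSemigroup using (interchange)
open import Relation.Nullary using (¬_; yes; no)

-- Defs keeps the disjunction over all vertices used by N private.  It is
-- recovered as the neighbourhood test at the centre of a star whose leaves
-- are selected by e, which makes anySelected-∷ hold definitionally.
private
  star : ∀ {m} → (Fin m → Bool) → Graph (suc m)
  star {m} e = record { adj = edge ; sym = edge-sym ; irrefl = edge-irrefl }
    where
    edge : Fin (suc m) → Fin (suc m) → Bool
    edge zero    zero    = false
    edge zero    (suc j) = e j
    edge (suc i) zero    = e i
    edge (suc i) (suc j) = false
    edge-sym : ∀ u v → edge u v ≡ edge v u
    edge-sym zero    zero    = refl
    edge-sym zero    (suc j) = refl
    edge-sym (suc i) zero    = refl
    edge-sym (suc i) (suc j) = refl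
    edge-irrefl : ∀ v → edge v v ≡ false
    edge-irrefl zero    = refl
    edge-irrefl (suc v) = refl

  anySelected : ∀ {m} → Subset m → (Fin m → Bool) → Bool
  anySelected S e = lookup (N (star e) Full (false ∷ S)) zero

  anySelected-∷ : ∀ {m} s (S : Subset m) (e : Fin (suc m) → Bool) →
    anySelected (s ∷ S) e ≡ ((s ∧ e zero) ∨ anySelected S (e ∘ suc))
  anySelected-∷ s S e = refl

∈⇒lookup : ∀ {m} {i : Fin m} {S : Subset m} → i ∈ S → lookup S i ≡ true
∈⇒lookup = []=⇒lookup

lookup⇒∈ : ∀ {m} {i : Fin m} {S : Subset m} → lookup S i ≡ true → i ∈ S
lookup⇒∈ {i = i} {S} = lookup⇒[]= i S

private
  anySelected⁻ : ∀ {m} (S : Subset m) e → anySelected S e ≡ true →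
    ∃ λ i → i ∈ S × e i ≡ true
  anySelected⁻ (true ∷ S) e eq with e zero in e0
  ... | true  = zero , here , e0
  ... | false with anySelected⁻ S (e ∘ suc) eq
  ...   | i , i∈S , ei = suc i , there i∈S , ei
  anySelected⁻ (false ∷ S) e eq with anySelected⁻ S (e ∘ suc) eq
  ... | i , i∈S , ei = suc i , there i∈S , ei

  anySelected⁺ : ∀ {m} (S : Subset m) e {i} → i ∈ S → e i ≡ true →
    anySelected S e ≡ true
  anySelected⁺ (s ∷ S) e here ei rewrite ei = refl
  anySelected⁺ (s ∷ S) e (there i∈S) ei =
    trans (anySelected-∷ s S e)
          (trans (cong ((s ∧ e zero) ∨_) (anySelected⁺ S (e ∘ suc) i∈S ei)) (∨-zeroʳ (s ∧ e zero)))

module _ {n : ℕ} (G : Graph n) where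

  private
    lookup-N : ∀ U S v → lookup (N G U S) v ≡
      (lookup U v ∧ not (lookup S v) ∧ anySelected S (λ u → adj G u v))
    lookup-N U S v = lookup∘tabulate _ v

  ∈N⁻ : ∀ U S {v} → v ∈ N G U S → v ∈ U × v ∉ S × ∃ λ u → u ∈ S × Adj G u v
  ∈N⁻ U S {v} v∈N with lookup U v in vU | lookup S v in vS
                        | anySelected S (λ u → adj G u v) in vA
                        | trans (sym (lookup-N U S v)) (∈⇒lookup v∈N)
  ... | true | false | true | _ =
    lookup⇒∈ vU , (λ v∈S → true≢false (trans (sym (∈⇒lookup v∈S)) vS)) , anySelected⁻ S _ vA
    where
    true≢false : true ≢ false
    true≢false ()

  ∈N⁺ : ∀ {U S v u} → v ∈ U → v ∉ S → u ∈ S → Adj G u v → v ∈ N G U S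
  ∈N⁺ {U} {S} {v} v∈U v∉S u∈S uv = lookup⇒∈ (trans (lookup-N U S v) value)
    where
    value : (lookup U v ∧ not (lookup S v) ∧ anySelected S (λ u → adj G u v)) ≡ true
    value with lookup S v in vS
    ... | true  = ⊥-elim (v∉S (lookup⇒∈ vS))
    ... | false rewrite ∈⇒lookup v∈U | anySelected⁺ S (λ u → adj G u v) u∈S uv = refl

  N-∉ : ∀ U S {v} → v ∈ N G U S → v ∉ S
  N-∉ U S v∈N = proj₁ (proj₂ (∈N⁻ U S v∈N))

x∈p─q⁻ : ∀ {m} {p q : Subset m} {x} → x ∈ p ─ q → x ∈ p × x ∉ q
x∈p─q⁻ {p = p} {q} x∈ = p─q⊆p p q x∈ , outside q x∈
  where
  outside : ∀ {m} {p : Subset m} (q : Subset m) {x} → x ∈ p ─ q → x ∉ q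
  outside {p = _ ∷ _} (false ∷ q) here        ()
  outside {p = _ ∷ _} (_ ∷ q)     (there x∈) (there x∈q) = outside q x∈ x∈q

x∈p⇒suc∣p-x∣≡∣p∣ : ∀ {m} (p : Subset m) {x} → x ∈ p → suc ∣ p - x ∣ ≡ ∣ p ∣
x∈p⇒suc∣p-x∣≡∣p∣ (true ∷ p)  here       = cong suc (cong ∣_∣ (p─⊥≡p p))
x∈p⇒suc∣p-x∣≡∣p∣ (true ∷ p)  (there x∈) = cong suc (x∈p⇒suc∣p-x∣≡∣p∣ p x∈)
x∈p⇒suc∣p-x∣≡∣p∣ (false ∷ p) (there x∈) = x∈p⇒suc∣p-x∣≡∣p∣ p x∈

∣p∣>0⇒Nonempty : ∀ {m} (p : Subset m) → 1 ≤ ∣ p ∣ → Nonempty p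
∣p∣>0⇒Nonempty (true ∷ p)  _ = zero , here
∣p∣>0⇒Nonempty (false ∷ p) c with ∣p∣>0⇒Nonempty p c
... | x , x∈ = suc x , there x∈

x∈p⇒∣p∣>0 : ∀ {m} {p : Subset m} {x} → x ∈ p → 1 ≤ ∣ p ∣
x∈p⇒∣p∣>0 x∈ = ℕₚ.≤-trans (s≤s z≤n) (x∈p⇒∣p-x∣<∣p∣ x∈)

∣p∩⁅x⁆∣≡1⇒x∈p : ∀ {m} {p : Subset m} {x} → ∣ p ∩ ⁅ x ⁆ ∣ ≡ 1 → x ∈ p
∣p∩⁅x⁆∣≡1⇒x∈p {p = p} {x} c with ∣p∣>0⇒Nonempty (p ∩ ⁅ x ⁆) (ℕₚ.≤-reflexive (sym c))
... | y , y∈ with x∈p∩q⁻ p ⁅ x ⁆ y∈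
... | y∈p , y∈⁅x⁆ = subst (_∈ p) (x∈⁅y⁆⇒x≡y x y∈⁅x⁆) y∈p

∣p∪q∣≤∣p∣+∣q∣ : ∀ {m} (p q : Subset m) → ∣ p ∪ q ∣ ≤ ∣ p ∣ + ∣ q ∣
∣p∪q∣≤∣p∣+∣q∣ [] [] = z≤n
∣p∪q∣≤∣p∣+∣q∣ (true ∷ p)  (true ∷ q)  = s≤s (ℕₚ.≤-trans (∣p∪q∣≤∣p∣+∣q∣ p q) (ℕₚ.+-monoʳ-≤ ∣ p ∣ (ℕₚ.n≤1+n _)))
∣p∪q∣≤∣p∣+∣q∣ (true ∷ p)  (false ∷ q) = s≤s (∣p∪q∣≤∣p∣+∣q∣ p q)
∣p∪q∣≤∣p∣+∣q∣ (false ∷ p) (true ∷ q)  = ℕₚ.≤-trans (s≤s (∣p∪q∣≤∣p∣+∣q∣ p q)) (ℕₚ.≤-reflexive (sym (ℕₚ.+-suc ∣ p ∣ ∣ q ∣)))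
∣p∪q∣≤∣p∣+∣q∣ (false ∷ p) (false ∷ q) = ∣p∪q∣≤∣p∣+∣q∣ p q

wt-∅ : ∀ {m} (w : Fin m → ℕ) → wt w ∅ ≡ 0
wt-∅ {zero}  w = refl
wt-∅ {suc m} w = wt-∅ (w ∘ suc)

wt-mono : ∀ {m} (w : Fin m → ℕ) {A B : Subset m} → A ⊆ B → wt w A ≤ wt w B
wt-mono {zero}  w {[]}        {[]}        A⊆B = z≤n
wt-mono {suc m} w {true ∷ A}  {true ∷ B}  A⊆B = ℕₚ.+-monoʳ-≤ (w zero) (wt-mono (w ∘ suc) (drop-∷-⊆ A⊆B))
wt-mono {suc m} w {true ∷ A}  {false ∷ B} A⊆B with A⊆B here
... | ()
wt-mono {suc m} w {false ∷ A} {true ∷ B}  A⊆B = ℕₚ.≤-trans (wt-mono (w ∘ suc) (drop-∷-⊆ A⊆B)) (ℕₚ.m≤n+m _ (w zero))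
wt-mono {suc m} w {false ∷ A} {false ∷ B} A⊆B = wt-mono (w ∘ suc) (drop-∷-⊆ A⊆B)

wt-∪-∩ : ∀ {m} (w : Fin m → ℕ) (A B : Subset m) → wt w (A ∪ B) + wt w (A ∩ B) ≡ wt w A + wt w B
wt-∪-∩ {zero}  w [] [] = refl
wt-∪-∩ {suc m} w (s ∷ A) (t ∷ B) = begin
  (head (s ∨ t) + wt w′ (A ∪ B)) + (head (s ∧ t) + wt w′ (A ∩ B))
    ≡⟨ interchange (head (s ∨ t)) _ (head (s ∧ t)) _ ⟩
  (head (s ∨ t) + head (s ∧ t)) + (wt w′ (A ∪ B) + wt w′ (A ∩ B))
    ≡⟨ cong₂ _+_ (head-∨-∧ s t) (wt-∪-∩ w′ A B) ⟩
  (head s + head t) + (wt w′ A + wt w′ B)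
    ≡⟨ interchange (head s) (head t) _ _ ⟩
  (head s + wt w′ A) + (head t + wt w′ B) ∎
  where
  open ≡-Reasoning
  w′ : Fin m → ℕ
  w′ = w ∘ suc
  head : Bool → ℕ
  head s = if s then w zero else 0
  head-∨-∧ : ∀ s t → head (s ∨ t) + head (s ∧ t) ≡ head s + head t
  head-∨-∧ true  true  = refl
  head-∨-∧ true  false = refl
  head-∨-∧ false t     = ℕₚ.+-identityʳ (head t)

wt-∪ : ∀ {m} (w : Fin m → ℕ) (A B : Subset m) → wt w (A ∪ B) ≤ wt w A + wt w B
wt-∪ w A B = ℕₚ.≤-trans (ℕₚ.m≤m+n _ _) (ℕₚ.≤-reflexive (wt-∪-∩ w A B))

wt-∪-disjoint : ∀ {m} (w : Fin m → ℕ) (A B : Subset m) → Empty (A ∩ B) →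
  wt w (A ∪ B) ≡ wt w A + wt w B
wt-∪-disjoint w A B A∩B=∅ = begin
  wt w (A ∪ B)                  ≡⟨ ℕₚ.+-identityʳ _ ⟨
  wt w (A ∪ B) + 0              ≡⟨ cong (wt w (A ∪ B) +_) (wt-∅ w) ⟨
  wt w (A ∪ B) + wt w ∅         ≡⟨ cong (λ C → wt w (A ∪ B) + wt w C) (Empty-unique A∩B=∅) ⟨
  wt w (A ∪ B) + wt w (A ∩ B)   ≡⟨ wt-∪-∩ w A B ⟩
  wt w A + wt w B               ∎
  where open ≡-Reasoning

wt-<-remove : ∀ {m} (w : Fin m → ℕ) → (∀ v → 1 ≤ w v) → ∀ (A : Subset m) {q} → q ∈ A →
  wt w (A - q) < wt w A
wt-<-remove w w>0 (true ∷ A) here =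
  subst (λ B → suc (wt (w ∘ suc) B) ≤ w zero + wt (w ∘ suc) A) (sym (p─⊥≡p A))
        (ℕₚ.+-monoˡ-≤ (wt (w ∘ suc) A) (w>0 zero))
wt-<-remove w w>0 (true ∷ A)  (there q∈) = ℕₚ.+-monoʳ-< (w zero) (wt-<-remove (w ∘ suc) (w>0 ∘ suc) A q∈)
wt-<-remove w w>0 (false ∷ A) (there q∈) = wt-<-remove (w ∘ suc) (w>0 ∘ suc) A q∈

-- Adjacency, degrees, walks and cycles

module _ {n : ℕ} (G : Graph n) where

  Adj-sym : ∀ {x y} → Adj G x y → Adj G y x
  Adj-sym {x} {y} xy = trans (Graph.sym G y x) xy

  Adj-irrefl : ∀ {x y} → Adj G x y → x ≢ y
  Adj-irrefl {x} xx refl with trans (sym xx) (Graph.irrefl G x)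
  ... | ()

  private
    neighbours : Fin n → Subset n
    neighbours v = tabulate (adj G v)

    neighbours⁺ : ∀ {v z} → Adj G v z → z ∈ neighbours v
    neighbours⁺ {v} {z} vz = lookup⇒∈ (trans (lookup∘tabulate (adj G v) z) vz)

    neighbours⁻ : ∀ {v z} → z ∈ neighbours v → Adj G v z
    neighbours⁻ {v} {z} z∈ = trans (sym (lookup∘tabulate (adj G v) z)) (∈⇒lookup z∈)

  deg≡2⇒neighbour : ∀ {v} → deg G v ≡ 2 → ∃ λ z → Adj G v z
  deg≡2⇒neighbour {v} d with ∣p∣>0⇒Nonempty (neighbours v) (ℕₚ.≤-trans (s≤s z≤n) (ℕₚ.≤-reflexive (sym d)))
  ... | z , z∈ = z , neighbours⁻ z∈

  deg≡2⇒other-neighbour : ∀ {v x} → deg G v ≡ 2 → Adj G v x → ∃ λ z → z ≢ x × Adj G v z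
  deg≡2⇒other-neighbour {v} {x} d vx
    with ∣p∣>0⇒Nonempty (neighbours v - x)
           (ℕₚ.≤-reflexive (sym (ℕₚ.suc-injective (trans (x∈p⇒suc∣p-x∣≡∣p∣ (neighbours v) (neighbours⁺ vx)) d))))
  ... | z , z∈ with x∈p─q⁻ z∈
  ... | z∈N , z∉⁅x⁆ = z , (λ z≡x → z∉⁅x⁆ (subst (_∈ ⁅ x ⁆) (sym z≡x) (x∈⁅x⁆ x))) , neighbours⁻ z∈N

  deg≡2⇒neighbour≡ : ∀ {v x y z} → deg G v ≡ 2 → Adj G v x → Adj G v y → x ≢ y → Adj G v z →
    z ≡ x ⊎ z ≡ y
  deg≡2⇒neighbour≡ {v} {x} {y} {z} d vx vy x≢y vz with z ≟ x | z ≟ y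
  ... | yes z≡x | _       = inj₁ z≡x
  ... | no _    | yes z≡y = inj₂ z≡y
  ... | no z≢x  | no z≢y  = ⊥-elim (ℕₚ.<-irrefl refl (ℕₚ.≤-trans (x∈p⇒∣p∣>0 z∈) (ℕₚ.≤-reflexive ∣rest∣≡0)))
    where
    y∈ : y ∈ neighbours v - x
    y∈ = x∈p∧x≢y⇒x∈p-y (neighbours⁺ vy) (x≢y ∘ sym)
    ∣rest∣≡0 : ∣ neighbours v - x - y ∣ ≡ 0
    ∣rest∣≡0 = ℕₚ.suc-injective (trans (x∈p⇒suc∣p-x∣≡∣p∣ (neighbours v - x) y∈)
                 (ℕₚ.suc-injective (trans (x∈p⇒suc∣p-x∣≡∣p∣ (neighbours v) (neighbours⁺ vx)) d)))
    z∈ : z ∈ neighbours v - x - y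
    z∈ = x∈p∧x≢y⇒x∈p-y (x∈p∧x≢y⇒x∈p-y (neighbours⁺ vz) z≢x) z≢y

  Reach-source : ∀ {C x y} → Reach G C x y → x ∈ C
  Reach-source (here x∈C)     = x∈C
  Reach-source (step x∈C _ _) = x∈C

  Reach-snoc : ∀ {C x y z} → Reach G C x y → Adj G y z → z ∈ C → Reach G C x z
  Reach-snoc (here y∈C)        yz z∈C = step y∈C yz (here z∈C)
  Reach-snoc (step x∈C xv vy)  yz z∈C = step x∈C xv (Reach-snoc vy yz z∈C)

  Reach-trans : ∀ {C x y z} → Reach G C x y → Reach G C y z → Reach G C x z
  Reach-trans (here _)         yz = yz
  Reach-trans (step x∈C xv vy) yz = step x∈C xv (Reach-trans vy yz)

  Reach-sym : ∀ {C x y} → Reach G C x y → Reach G C y x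
  Reach-sym (here x∈C)        = here x∈C
  Reach-sym (step x∈C xv vy)  = Reach-snoc (Reach-sym vy) (Adj-sym xv) x∈C

  Reach-mono : ∀ {C D x y} → C ⊆ D → Reach G C x y → Reach G D x y
  Reach-mono C⊆D (here x∈C)       = here (C⊆D x∈C)
  Reach-mono C⊆D (step x∈C xv vy) = step (C⊆D x∈C) xv (Reach-mono C⊆D vy)

  Reach-stays-in : ∀ {W H x y} → (∀ {v} → v ∈ W → v ∉ N G Full H) → Reach G W x y → x ∈ H → y ∈ H
  Reach-stays-in W∩N=∅ (here _) x∈H = x∈H
  Reach-stays-in {H = H} W∩N=∅ (step {v = v} _ xv vy) x∈H with v ∈? H
  ... | yes v∈H = Reach-stays-in W∩N=∅ vy v∈H
  ... | no v∉H  = ⊥-elim (W∩N=∅ (Reach-source vy) (∈N⁺ G ∈⊤ v∉H x∈H xv))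

  Acyclic-mono : ∀ {A B} → A ⊆ B → Acyclic G B → Acyclic G A
  Acyclic-mono A⊆B acyclic x xs (len , unique , inA , chain) = acyclic x xs (len , unique , All.map A⊆B inA , chain)

  Cycle : Subset n → List (Fin n) → Set
  Cycle C []       = ⊥
  Cycle C (x ∷ xs) = IsCycle G C x xs

  private
    AdjChain-snoc : ∀ l y z → AdjChain G (l ++ y ∷ []) → Adj G y z → AdjChain G (l ++ y ∷ z ∷ [])
    AdjChain-snoc []           y z _               yz = yz , tt
    AdjChain-snoc (x ∷ [])     y z (xy , _)        yz = xy , yz , tt
    AdjChain-snoc (x ∷ x′ ∷ l) y z (xx′ , chain)   yz = xx′ , AdjChain-snoc (x′ ∷ l) y z chain yz

    Cycle-rotate : ∀ {C} x l → Cycle C (x ∷ l) → Cycle C (l ++ x ∷ [])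
    Cycle-rotate x [] (() , _)
    Cycle-rotate {C} x (y ∷ ys) (len , (x∉ ∷ y∉ ∷ unique) , (x∈C ∷ y∈C ∷ ys∈C) , (xy , chain)) =
      len′ , (Allₚ.++⁺ y∉ (y≢x ∷ []) ∷ Uniqueₚ.++⁺ unique ([] ∷ []) disjoint) ,
      (y∈C ∷ Allₚ.++⁺ ys∈C (x∈C ∷ [])) , chain′
      where
      len′ : 2 ≤ length (ys ++ x ∷ [])
      len′ = subst (2 ≤_) (trans (ℕₚ.+-comm 1 (length ys)) (sym (length-++ ys))) len
      y≢x : y ≢ x
      y≢x y≡x = All.head x∉ (sym y≡x)
      disjoint : ∀ {v} → ¬ (v ∈ₗ ys × v ∈ₗ (x ∷ []))
      disjoint (v∈ys , Any.here refl) = All.lookup x∉ (Any.there v∈ys) refl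
      chain′ : AdjChain G (y ∷ (ys ++ x ∷ []) ++ y ∷ [])
      chain′ = subst (λ l → AdjChain G (y ∷ l)) (sym (++-assoc ys (x ∷ []) (y ∷ [])))
                 (AdjChain-snoc (y ∷ ys) x y chain xy)

    Cycle-rotate-to : ∀ {C} pre v post → Cycle C (pre ++ v ∷ post) → Cycle C (v ∷ post ++ pre)
    Cycle-rotate-to {C} [] v post c = subst (λ l → Cycle C (v ∷ l)) (sym (++-identityʳ post)) c
    Cycle-rotate-to {C} (x ∷ pre) v post c =
      subst (λ l → Cycle C (v ∷ l)) (++-assoc post (x ∷ []) pre)
        (Cycle-rotate-to pre v (post ++ x ∷ [])
          (subst (Cycle C) (++-assoc pre (v ∷ post) (x ∷ [])) (Cycle-rotate x (pre ++ v ∷ post) c)))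

    last-neighbour : ∀ y t ts z → AdjChain G (y ∷ t ∷ ts ++ z ∷ []) → ∃ λ s → s ∈ₗ (t ∷ ts) × Adj G s z
    last-neighbour y t []        z (_ , tz , _) = t , Any.here refl , tz
    last-neighbour y t (t′ ∷ ts) z (_ , chain) with last-neighbour t t′ ts z chain
    ... | s , s∈ , sz = s , Any.there s∈ , sz

  TwoNeighboursIn : List (Fin n) → Fin n → Set
  TwoNeighboursIn L v = ∃ λ y₁ → ∃ λ y₂ → y₁ ≢ y₂ × y₁ ∈ₗ L × y₂ ∈ₗ L × Adj G v y₁ × Adj G v y₂

  private
    cycle-head-neighbours : ∀ {C} x xs → IsCycle G C x xs → TwoNeighboursIn xs x
    cycle-head-neighbours x [] (() , _)
    cycle-head-neighbours x (_ ∷ []) (s≤s () , _)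
    cycle-head-neighbours x (r₁ ∷ r₂ ∷ rs) (_ , (_ ∷ r₁∉ ∷ _) , _ , (xr₁ , chain))
      with last-neighbour r₁ r₂ rs x chain
    ... | s , s∈ , sx = r₁ , s , All.lookup r₁∉ s∈ , Any.here refl , Any.there s∈ , xr₁ , Adj-sym sx

  cycle-neighbours : ∀ {C} x xs v → IsCycle G C x xs → v ∈ₗ (x ∷ xs) → TwoNeighboursIn (x ∷ xs) v
  cycle-neighbours {C} x xs v cycle v∈ with ∈-∃++ v∈
  ... | pre , post , x∷xs≡ with cycle-head-neighbours v (post ++ pre)
                                  (Cycle-rotate-to pre v post (subst (Cycle C) x∷xs≡ cycle))
  ... | y₁ , y₂ , y₁≢y₂ , y₁∈ , y₂∈ , vy₁ , vy₂ = y₁ , y₂ , y₁≢y₂ , back y₁∈ , back y₂∈ , vy₁ , vy₂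
    where
    back : ∀ {z} → z ∈ₗ (post ++ pre) → z ∈ₗ (x ∷ xs)
    back {z} z∈ = subst (z ∈ₗ_) (sym x∷xs≡) (reinsert (∈-++⁻ post z∈))
      where
      reinsert : z ∈ₗ post ⊎ z ∈ₗ pre → z ∈ₗ (pre ++ v ∷ post)
      reinsert (inj₁ z∈post) = ∈-++⁺ʳ pre (Any.there z∈post)
      reinsert (inj₂ z∈pre)  = ∈-++⁺ˡ z∈pre

-- Induced paths whose vertices have degree two

upward : ∀ (Z : ℕ → Set) {i j} → i ≤ j → Z i → (∀ t → i ≤ t → t < j → Z t → Z (suc t)) → Z j
upward Z {j = zero}  z≤n Zi next = Zi
upward Z {j = suc j} i≤j Zi next with ℕₚ.m≤n⇒m<n∨m≡n i≤j
... | inj₂ refl      = Zi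
... | inj₁ (s≤s i≤j′) = next j i≤j′ ℕₚ.≤-refl (upward Z i≤j′ Zi (λ t i≤t t<j → next t i≤t (ℕₚ.m≤n⇒m≤1+n t<j)))

downward : ∀ (Z : ℕ → Set) {i j} → j ≤ i → Z i → (∀ t → j ≤ t → t < i → Z (suc t) → Z t) → Z j
downward Z {i = zero}  z≤n Zi next = Zi
downward Z {i = suc i} j≤i Zi next with ℕₚ.m≤n⇒m<n∨m≡n j≤i
... | inj₂ refl      = Zi
... | inj₁ (s≤s j≤i′) = downward Z j≤i′ (next i j≤i′ ℕₚ.≤-refl Zi) (λ t j≤t t<i → next t j≤t (ℕₚ.m≤n⇒m≤1+n t<i))

record DegreeTwoPath {n : ℕ} (G : Graph n) : Set where
  field
    m           : ℕ
    u           : ℕ → Fin n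
    P           : Subset n
    u-adj       : ∀ i → suc i < m → Adj G (u i) (u (suc i))
    u-injective : ∀ i k → i < m → k < m → u i ≡ u k → i ≡ k
    deg≡2       : ∀ i → i < m → deg G (u i) ≡ 2
    ∈P⇒index    : ∀ {v} → v ∈ P → ∃ λ i → i < m × u i ≡ v
    index⇒∈P    : ∀ i → i < m → u i ∈ P
    a b         : Fin n
    a∉P         : a ∉ P
    a-attached  : ∃ λ i → i < m × Adj G (u i) a
    exits       : ∀ i v → i < m → Adj G (u i) v → v ∉ P → v ≡ a ⊎ v ≡ b

module DegreeTwoPathProperties {n : ℕ} {G : Graph n} (path : DegreeTwoPath G) where
  open DegreeTwoPath path

  ∉P⇒≢u : ∀ {v} i → i < m → v ∉ P → v ≢ u i
  ∉P⇒≢u i i<m v∉P refl = v∉P (index⇒∈P i i<m)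

  last-index : 2 ≤ m → ∃ λ L → suc (suc L) ≡ m
  last-index 2≤m = m ∸ 2 , trans (ℕₚ.+-comm 2 (m ∸ 2)) (ℕₚ.m∸n+n≡m 2≤m)

  inner-neighbours : ∀ j v → suc (suc j) < m → Adj G (u (suc j)) v → v ≡ u j ⊎ v ≡ u (suc (suc j))
  inner-neighbours j v j+2<m =
    deg≡2⇒neighbour≡ G (deg≡2 (suc j) j+1<m) (Adj-sym G (u-adj j j+1<m)) (u-adj (suc j) j+2<m) u-j≢u-j+2
    where
    j+1<m : suc j < m
    j+1<m = ℕₚ.<-trans (ℕₚ.n<1+n _) j+2<m
    u-j≢u-j+2 : u j ≢ u (suc (suc j))
    u-j≢u-j+2 e = ℕₚ.<⇒≢ (ℕₚ.<-trans (ℕₚ.n<1+n j) (ℕₚ.n<1+n _))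
                    (u-injective j (suc (suc j)) (ℕₚ.<-trans (ℕₚ.n<1+n j) j+1<m) j+2<m e)

  -- The exit to a rules out an edge closing the path into a cycle.
  ends-not-adjacent : ∀ L → suc L ≡ m → 2 ≤ L → ¬ Adj G (u 0) (u L)
  ends-not-adjacent L L+1≡m 2≤L u0uL with a-attached
  ... | zero , _ , u0a
    with deg≡2⇒neighbour≡ G (deg≡2 0 (ℕₚ.≤-trans (s≤s z≤n) L<m)) (u-adj 0 2≤m) u0uL
           (λ e → ℕₚ.<⇒≢ 2≤L (u-injective 1 L 2≤m L<m e)) u0a
    where
    L<m : L < m
    L<m = ℕₚ.≤-reflexive L+1≡m
    2≤m : 2 ≤ m
    2≤m = ℕₚ.<-trans 2≤L L<m
  ... | inj₁ e = ∉P⇒≢u 1 (ℕₚ.<-trans 2≤L (ℕₚ.≤-reflexive L+1≡m)) a∉P e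
  ... | inj₂ e = ∉P⇒≢u L (ℕₚ.≤-reflexive L+1≡m) a∉P e
  ends-not-adjacent L L+1≡m 2≤L u0uL | suc k , k+1<m , uk+1a with ℕₚ.m≤n⇒m<n∨m≡n k+1<m
  ... | inj₁ k+2<m with inner-neighbours k a k+2<m uk+1a
  ...   | inj₁ e = ∉P⇒≢u k (ℕₚ.<-trans (ℕₚ.n<1+n k) k+1<m) a∉P e
  ...   | inj₂ e = ∉P⇒≢u (suc (suc k)) k+2<m a∉P e
  ends-not-adjacent L L+1≡m 2≤L u0uL | suc k , k+1<m , uk+1a | inj₂ k+2≡m
    with ℕₚ.suc-injective (trans k+2≡m (sym L+1≡m))
  ... | refl with deg≡2⇒neighbour≡ G (deg≡2 (suc k) k+1<m) (Adj-sym G (u-adj k k+1<m)) (Adj-sym G u0uL) uk≢u0 uk+1a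
    where
    uk≢u0 : u k ≢ u 0
    uk≢u0 e = ℕₚ.<⇒≢ 2≤L (sym (cong suc (u-injective k 0 (ℕₚ.<-trans (ℕₚ.n<1+n k) k+1<m) (ℕₚ.≤-trans (s≤s z≤n) k+1<m) e)))
  ... | inj₁ e = ∉P⇒≢u k (ℕₚ.<-trans (ℕₚ.n<1+n k) k+1<m) a∉P e
  ... | inj₂ e = ∉P⇒≢u 0 (ℕₚ.≤-trans (s≤s z≤n) k+1<m) a∉P e

  adjacent⇒consecutive : ∀ i k → i < m → k < m → Adj G (u i) (u k) → k ≡ suc i ⊎ i ≡ suc k
  adjacent⇒consecutive zero zero _ _ uu = ⊥-elim (Adj-irrefl G uu refl)
  adjacent⇒consecutive zero (suc zero) _ _ _ = inj₁ refl
  adjacent⇒consecutive zero (suc (suc k)) 0<m k+2<m uu with ℕₚ.m≤n⇒m<n∨m≡n k+2<m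
  ... | inj₂ k+3≡m = ⊥-elim (ends-not-adjacent (suc (suc k)) k+3≡m (s≤s (s≤s z≤n)) uu)
  ... | inj₁ k+3<m with inner-neighbours (suc k) (u 0) k+3<m (Adj-sym G uu)
  ...   | inj₁ e with u-injective 0 (suc k) 0<m (ℕₚ.<-trans (ℕₚ.n<1+n _) k+2<m) e
  ...     | ()
  adjacent⇒consecutive zero (suc (suc k)) 0<m k+2<m uu | inj₁ k+3<m | inj₂ e
    with u-injective 0 (suc (suc (suc k))) 0<m k+3<m e
  ... | ()
  adjacent⇒consecutive (suc j) k j+1<m k<m uu with ℕₚ.m≤n⇒m<n∨m≡n j+1<m
  ... | inj₁ j+2<m with inner-neighbours j (u k) j+2<m uu
  ...   | inj₁ e = inj₂ (cong suc (sym (u-injective k j k<m (ℕₚ.<-trans (ℕₚ.n<1+n _) j+1<m) e)))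
  ...   | inj₂ e = inj₁ (u-injective k (suc (suc j)) k<m j+2<m e)
  adjacent⇒consecutive (suc zero) zero _ _ _ | inj₂ _ = inj₂ refl
  adjacent⇒consecutive (suc (suc j)) zero _ _ uu | inj₂ j+3≡m =
    ⊥-elim (ends-not-adjacent (suc (suc j)) j+3≡m (s≤s (s≤s z≤n)) (Adj-sym G uu))
  adjacent⇒consecutive (suc j) (suc k) j+1<m k+1<m uu | inj₂ j+2≡m with ℕₚ.m≤n⇒m<n∨m≡n k+1<m
  ... | inj₁ k+2<m with inner-neighbours k (u (suc j)) k+2<m (Adj-sym G uu)
  ...   | inj₁ e = inj₁ (cong suc (sym (u-injective (suc j) k j+1<m (ℕₚ.<-trans (ℕₚ.n<1+n _) k+1<m) e)))
  ...   | inj₂ e = inj₂ (u-injective (suc j) (suc (suc k)) j+1<m k+2<m e)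
  adjacent⇒consecutive (suc j) (suc k) _ _ uu | inj₂ j+2≡m | inj₂ k+2≡m
    with ℕₚ.suc-injective (trans k+2≡m (sym j+2≡m))
  ... | refl = ⊥-elim (Adj-irrefl G uu refl)

  exit⇒end : ∀ i v → i < m → Adj G (u i) v → v ∉ P → i ≡ 0 ⊎ suc i ≡ m
  exit⇒end zero    v _     _  _   = inj₁ refl
  exit⇒end (suc j) v j+1<m uv v∉P with ℕₚ.m≤n⇒m<n∨m≡n j+1<m
  ... | inj₂ j+2≡m = inj₂ j+2≡m
  ... | inj₁ j+2<m with inner-neighbours j v j+2<m uv
  ...   | inj₁ e = ⊥-elim (∉P⇒≢u j (ℕₚ.<-trans (ℕₚ.n<1+n _) j+1<m) v∉P e)
  ...   | inj₂ e = ⊥-elim (∉P⇒≢u (suc (suc j)) j+2<m v∉P e)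

  first-exit : 2 ≤ m → ∃ λ w → w ∉ P × Adj G (u 0) w
  first-exit 2≤m with deg≡2⇒other-neighbour G (deg≡2 0 0<m) (u-adj 0 2≤m)
    where
    0<m : 0 < m
    0<m = ℕₚ.≤-trans (s≤s z≤n) 2≤m
  ... | z , z≢u1 , u0z with z ∈? P
  ... | no z∉P = z , z∉P , u0z
  ... | yes z∈P with ∈P⇒index z∈P
  ...   | k , k<m , refl with adjacent⇒consecutive 0 k (ℕₚ.≤-trans (s≤s z≤n) 2≤m) k<m u0z
  ...     | inj₁ refl = ⊥-elim (z≢u1 refl)
  ...     | inj₂ ()

  last-exit : ∀ L → suc (suc L) ≡ m → ∃ λ w → w ∉ P × Adj G (u (suc L)) w
  last-exit L L+2≡m with deg≡2⇒other-neighbour G (deg≡2 (suc L) (ℕₚ.≤-reflexive L+2≡m))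
                           (Adj-sym G (u-adj L (ℕₚ.≤-reflexive L+2≡m)))
  ... | z , z≢uL , uL+1z with z ∈? P
  ... | no z∉P = z , z∉P , uL+1z
  ... | yes z∈P with ∈P⇒index z∈P
  ...   | k , k<m , refl with adjacent⇒consecutive (suc L) k (ℕₚ.≤-reflexive L+2≡m) k<m uL+1z
  ...     | inj₁ refl = ⊥-elim (ℕₚ.<-irrefl L+2≡m k<m)
  ...     | inj₂ refl = ⊥-elim (z≢uL refl)

  first-exit-unique : ∀ {w w′} → 2 ≤ m → Adj G (u 0) w → Adj G (u 0) w′ → w ∉ P → w′ ∉ P → w′ ≡ w
  first-exit-unique 2≤m u0w u0w′ w∉P w′∉P
    with deg≡2⇒neighbour≡ G (deg≡2 0 (ℕₚ.≤-trans (s≤s z≤n) 2≤m)) (u-adj 0 2≤m) u0w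
           (λ e → ∉P⇒≢u 1 2≤m w∉P (sym e)) u0w′
  ... | inj₁ e = ⊥-elim (∉P⇒≢u 1 2≤m w′∉P e)
  ... | inj₂ e = e

  last-exit-unique : ∀ {w w′} L → suc (suc L) ≡ m → Adj G (u (suc L)) w → Adj G (u (suc L)) w′ →
    w ∉ P → w′ ∉ P → w′ ≡ w
  last-exit-unique L L+2≡m uw uw′ w∉P w′∉P
    with deg≡2⇒neighbour≡ G (deg≡2 (suc L) L+1<m) (Adj-sym G (u-adj L L+1<m)) uw
           (λ e → ∉P⇒≢u L (ℕₚ.<-trans (ℕₚ.n<1+n _) L+1<m) w∉P (sym e)) uw′
    where
    L+1<m : suc L < m
    L+1<m = ℕₚ.≤-reflexive L+2≡m
  ... | inj₁ e = ⊥-elim (∉P⇒≢u L (ℕₚ.≤-trans (ℕₚ.n≤1+n _) (ℕₚ.≤-reflexive L+2≡m)) w′∉P e)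
  ... | inj₂ e = e

-- Cutting the path at an inner vertex p

module Cut {n : ℕ} {G : Graph n} (path : DegreeTwoPath G) (j : ℕ) (j<m : j < DegreeTwoPath.m path) where
  open DegreeTwoPath path
  open DegreeTwoPathProperties path

  p : Fin n
  p = u j

  Q : Subset n
  Q = P - p

  Q⁻ : ∀ {q} → q ∈ Q → q ∈ P × q ≢ p
  Q⁻ {q} q∈Q with x∈p─q⁻ q∈Q
  ... | q∈P , q∉⁅p⁆ = q∈P , λ q≡p → q∉⁅p⁆ (subst (_∈ ⁅ p ⁆) (sym q≡p) (x∈⁅x⁆ p))

  p∈P : p ∈ P
  p∈P = index⇒∈P j j<m

  p∉Q : p ∉ Q
  p∉Q p∈Q = proj₂ (Q⁻ p∈Q) refl

  u∈Q : ∀ t → t < m → t ≢ j → u t ∈ Q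
  u∈Q t t<m t≢j = x∈p∧x∉q⇒x∈p─q (index⇒∈P t t<m) (λ ut∈⁅p⁆ → t≢j (u-injective t j t<m j<m (x∈⁅y⁆⇒x≡y p ut∈⁅p⁆)))

  Q⇒index : ∀ {q} → q ∈ Q → ∃ λ i → i < m × u i ≡ q × i ≢ j
  Q⇒index q∈Q with Q⁻ q∈Q
  ... | q∈P , q≢p with ∈P⇒index q∈P
  ...   | i , i<m , refl = i , i<m , refl , λ { refl → q≢p refl }

  private
    through-exit : ∀ {W w q} → w ≡ a ⊎ w ≡ b → Reach G W w q → Reach G W a q ⊎ Reach G W b q
    through-exit (inj₁ refl) w⇝q = inj₁ w⇝q
    through-exit (inj₂ refl) w⇝q = inj₂ w⇝q

    exit∈ : ∀ {W w} → w ≡ a ⊎ w ≡ b → a ∈ W → b ∈ W → w ∈ W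
    exit∈ (inj₁ refl) a∈W _   = a∈W
    exit∈ (inj₂ refl) _   b∈W = b∈W

  Q-reachable : ∀ {W} → Q ⊆ W → a ∈ W → b ∈ W → ∀ {q} → q ∈ Q → Reach G W a q ⊎ Reach G W b q
  Q-reachable {W} Q⊆W a∈W b∈W q∈Q with Q⇒index q∈Q
  ... | i , i<m , refl , i≢j with ℕₚ.<-cmp i j
  ... | tri≈ _ i≡j _ = ⊥-elim (i≢j i≡j)
  ... | tri< i<j _ _ with first-exit 2≤m
    where
    2≤m : 2 ≤ m
    2≤m = ℕₚ.≤-trans (s≤s (ℕₚ.≤-trans (s≤s z≤n) i<j)) j<m
  ...   | w , w∉P , u0w = through-exit w≡a∨b (upward (Reach G W w ∘ u) z≤n w⇝u0 forward)
    where
    w≡a∨b : w ≡ a ⊎ w ≡ b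
    w≡a∨b = exits 0 w (ℕₚ.≤-trans (s≤s z≤n) i<m) u0w w∉P
    u∈W : ∀ t → t ≤ i → u t ∈ W
    u∈W t t≤i = Q⊆W (u∈Q t (ℕₚ.≤-<-trans t≤i i<m) (ℕₚ.<⇒≢ (ℕₚ.≤-<-trans t≤i i<j)))
    w⇝u0 : Reach G W w (u 0)
    w⇝u0 = step (exit∈ w≡a∨b a∈W b∈W) (Adj-sym G u0w) (here (u∈W 0 z≤n))
    forward : ∀ t → 0 ≤ t → t < i → Reach G W w (u t) → Reach G W w (u (suc t))
    forward t _ t<i w⇝ut = Reach-snoc G w⇝ut (u-adj t (ℕₚ.≤-trans (s≤s t<i) i<m)) (u∈W (suc t) t<i)
  Q-reachable {W} Q⊆W a∈W b∈W q∈Q | i , i<m , refl , i≢j | tri> _ _ j<i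
    with last-index (ℕₚ.≤-trans (s≤s (ℕₚ.≤-trans (s≤s z≤n) j<i)) i<m)
  ... | L , L+2≡m with last-exit L L+2≡m
  ... | w , w∉P , uw = through-exit w≡a∨b (downward (Reach G W w ∘ u) i≤L+1 w⇝uL+1 backward)
    where
    L+1<m : suc L < m
    L+1<m = ℕₚ.≤-reflexive L+2≡m
    i≤L+1 : i ≤ suc L
    i≤L+1 = ℕₚ.≤-pred (ℕₚ.<-≤-trans i<m (ℕₚ.≤-reflexive (sym L+2≡m)))
    w≡a∨b : w ≡ a ⊎ w ≡ b
    w≡a∨b = exits (suc L) w L+1<m uw w∉P
    u∈W : ∀ t → i ≤ t → t ≤ suc L → u t ∈ W
    u∈W t i≤t t≤L+1 = Q⊆W (u∈Q t (ℕₚ.≤-<-trans t≤L+1 L+1<m) (λ t≡j → ℕₚ.<⇒≢ (ℕₚ.<-≤-trans j<i i≤t) (sym t≡j)))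
    w⇝uL+1 : Reach G W w (u (suc L))
    w⇝uL+1 = step (exit∈ w≡a∨b a∈W b∈W) (Adj-sym G uw) (here (u∈W (suc L) i≤L+1 ℕₚ.≤-refl))
    backward : ∀ t → i ≤ t → t < suc L → Reach G W w (u (suc t)) → Reach G W w (u t)
    backward t i≤t t<L+1 w⇝ut+1 =
      Reach-snoc G w⇝ut+1 (Adj-sym G (u-adj t (ℕₚ.≤-trans (s≤s t<L+1) L+1<m))) (u∈W t i≤t (ℕₚ.<⇒≤ t<L+1))

  -- A walk avoiding p that sits at c last left G - P at w: at c itself if c ∉ P, and
  -- otherwise at the exit of the half of the path containing c.
  data Shadow (c : Fin n) : Fin n → Set where
    outside : c ∉ P → Shadow c c
    front   : ∀ {i w} → i < j → u i ≡ c → w ∉ P → Adj G (u 0) w → Shadow c w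
    back    : ∀ {i w} L → j < i → i < m → u i ≡ c → w ∉ P → suc (suc L) ≡ m →
              Adj G (u (suc L)) w → Shadow c w

  ShadowStep : Fin n → Fin n → Set
  ShadowStep w c′ = ∃ λ w′ → Shadow c′ w′ × (w′ ≡ w ⊎ (w′ ≡ c′ × c′ ∉ P × Adj G w c′))

  private
    u≢p : ∀ {i} → u i ≢ p → i ≢ j
    u≢p ui≢p refl = ui≢p refl

  shadow-step : ∀ {c w c′} → Shadow c w → Adj G c c′ → c′ ≢ p → ShadowStep w c′
  shadow-step {c} {c′ = c′} (outside c∉P) cc′ c′≢p with c′ ∈? P
  ... | no c′∉P = c′ , outside c′∉P , inj₂ (refl , c′∉P , cc′)
  ... | yes c′∈P with ∈P⇒index c′∈P
  ...   | i , i<m , refl with exit⇒end i c i<m (Adj-sym G cc′) c∉P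
  ...     | inj₁ refl = c , front (ℕₚ.≤∧≢⇒< z≤n (u≢p c′≢p)) refl c∉P (Adj-sym G cc′) , inj₁ refl
  ...     | inj₂ i+1≡m with ℕₚ.<-cmp i j
  ...       | tri< i<j _ _ = ⊥-elim (ℕₚ.<-irrefl refl (ℕₚ.≤-trans j<m (ℕₚ.≤-trans (ℕₚ.≤-reflexive (sym i+1≡m)) i<j)))
  ...       | tri≈ _ i≡j _ = ⊥-elim (u≢p c′≢p i≡j)
  shadow-step {c} (outside c∉P) cc′ c′≢p | yes _ | suc L , i<m , refl | inj₂ i+1≡m | tri> _ _ j<i =
    c , back L j<i i<m refl c∉P i+1≡m (Adj-sym G cc′) , inj₁ refl
  shadow-step {c′ = c′} (front {i} i<j refl w∉P u0w) cc′ c′≢p with c′ ∈? P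
  ... | no c′∉P with exit⇒end i c′ (ℕₚ.<-trans i<j j<m) cc′ c′∉P
  ...   | inj₁ refl = _ , subst (Shadow c′) (first-exit-unique 2≤m u0w cc′ w∉P c′∉P) (outside c′∉P) , inj₁ refl
    where
    2≤m : 2 ≤ m
    2≤m = ℕₚ.≤-trans (s≤s i<j) j<m
  ...   | inj₂ i+1≡m = ⊥-elim (ℕₚ.<-irrefl refl (ℕₚ.≤-trans j<m (ℕₚ.≤-trans (ℕₚ.≤-reflexive (sym i+1≡m)) i<j)))
  shadow-step (front {i} i<j refl w∉P u0w) cc′ c′≢p | yes c′∈P with ∈P⇒index c′∈P
  ... | i′ , i′<m , refl with adjacent⇒consecutive i i′ (ℕₚ.<-trans i<j j<m) i′<m cc′
  ...   | inj₁ refl = _ , front (ℕₚ.≤∧≢⇒< i<j (u≢p c′≢p)) refl w∉P u0w , inj₁ refl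
  ...   | inj₂ refl = _ , front (ℕₚ.<-trans (ℕₚ.n<1+n i′) i<j) refl w∉P u0w , inj₁ refl
  shadow-step {c′ = c′} (back {i} L j<i i<m refl w∉P L+2≡m uw) cc′ c′≢p with c′ ∈? P
  ... | no c′∉P with exit⇒end i c′ i<m cc′ c′∉P
  ...   | inj₁ refl with j<i
  ...     | ()
  shadow-step {c′ = c′} (back {i} L j<i i<m refl w∉P L+2≡m uw) cc′ c′≢p | no c′∉P | inj₂ i+1≡m
    with ℕₚ.suc-injective (trans i+1≡m (sym L+2≡m))
  ... | refl = _ , subst (Shadow c′) (last-exit-unique L L+2≡m uw cc′ w∉P c′∉P) (outside c′∉P) , inj₁ refl
  shadow-step (back {i} L j<i i<m refl w∉P L+2≡m uw) cc′ c′≢p | yes c′∈P with ∈P⇒index c′∈P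
  ... | i′ , i′<m , refl with adjacent⇒consecutive i i′ i<m i′<m cc′
  ...   | inj₁ refl = _ , back L (ℕₚ.<-trans j<i (ℕₚ.n<1+n i)) i′<m refl w∉P L+2≡m uw , inj₁ refl
  ...   | inj₂ refl = _ , back L (ℕₚ.≤∧≢⇒< (ℕₚ.≤-pred j<i) (u≢p c′≢p ∘ sym)) i′<m refl w∉P L+2≡m uw , inj₁ refl

  shadow-walk : ∀ {H s c t w} → p ∉ H → Reach G H c t → Shadow c w → Reach G (H ∩ ∁ P) s w →
    ∃ λ w′ → Shadow t w′ × Reach G (H ∩ ∁ P) s w′
  shadow-walk p∉H (here _) sh s⇝w = _ , sh , s⇝w
  shadow-walk {H} p∉H (step _ cc′ c′⇝t) sh s⇝w
    with shadow-step sh cc′ (λ c′≡p → p∉H (subst (_∈ H) c′≡p (Reach-source G c′⇝t)))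
  ... | _ , sh′ , inj₁ refl = shadow-walk p∉H c′⇝t sh′ s⇝w
  ... | _ , sh′ , inj₂ (refl , c′∉P , wc′) =
    shadow-walk p∉H c′⇝t sh′ (Reach-snoc G s⇝w wc′ (x∈p∩q⁺ (Reach-source G c′⇝t , x∉p⇒x∈∁p c′∉P)))

  connected-∖P : ∀ {H} → p ∉ H → Connected G H → Connected G (H ∩ ∁ P)
  connected-∖P {H} p∉H connected x y x∈ y∈ with x∈p∩q⁻ H (∁ P) x∈ | x∈p∩q⁻ H (∁ P) y∈
  ... | x∈H , x∈∁P | y∈H , y∈∁P
    with shadow-walk p∉H (connected x y x∈H y∈H) (outside (x∈∁p⇒x∉p x∈∁P)) (here x∈)
  ... | _ , outside _ , x⇝y = x⇝y
  ... | _ , front {i} i<j refl _ _ , _ = ⊥-elim (x∈∁p⇒x∉p y∈∁P (index⇒∈P i (ℕₚ.<-trans i<j j<m)))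
  ... | _ , back {i} _ _ i<m refl _ _ _ , _ = ⊥-elim (x∈∁p⇒x∉p y∈∁P (index⇒∈P i i<m))

  -- Vertices of degree two on a cycle have both neighbours on it, so a cycle through
  -- Q would run along the path into p.
  acyclic-∪Q : ∀ {A} → (∀ {v} → v ∈ A → v ∉ P) → Acyclic G A → Acyclic G (A ∪ Q)
  acyclic-∪Q {A} A∩P=∅ acyclic x xs cycle@(len , unique , inA∪Q , chain)
    with All.all? (_∈? A) (x ∷ xs)
  ... | yes inA = acyclic x xs (len , unique , inA , chain)
  ... | no ¬inA with find (Allₚ.¬All⇒Any¬ (_∈? A) (x ∷ xs) ¬inA)
  ... | c , c∈L , c∉A with x∈p∪q⁻ A Q (All.lookup inA∪Q c∈L)
  ...   | inj₁ c∈A = c∉A c∈A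
  ...   | inj₂ c∈Q with Q⇒index c∈Q
  ...     | i , i<m , refl , i≢j = p∉L p∈L
    where
    L : List (Fin n)
    L = x ∷ xs
    closed : ∀ t {z} → t < m → u t ∈ₗ L → Adj G (u t) z → z ∈ₗ L
    closed t t<m ut∈L utz with cycle-neighbours G x xs (u t) cycle ut∈L
    ... | y₁ , y₂ , y₁≢y₂ , y₁∈L , y₂∈L , uty₁ , uty₂
      with deg≡2⇒neighbour≡ G (deg≡2 t t<m) uty₁ uty₂ y₁≢y₂ utz
    ... | inj₁ refl = y₁∈L
    ... | inj₂ refl = y₂∈L
    p∉L : p ∈ₗ L → ⊥
    p∉L p∈L with x∈p∪q⁻ A Q (All.lookup inA∪Q p∈L)
    ... | inj₁ p∈A = A∩P=∅ p∈A p∈P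
    ... | inj₂ p∈Q = p∉Q p∈Q
    p∈L : p ∈ₗ L
    p∈L with ℕₚ.<-cmp i j
    ... | tri≈ _ i≡j _ = ⊥-elim (i≢j i≡j)
    ... | tri< i<j _ _ = upward (λ t → u t ∈ₗ L) (ℕₚ.<⇒≤ i<j) c∈L
        λ t _ t<j ut∈L → closed t (ℕₚ.<-trans t<j j<m) ut∈L (u-adj t (ℕₚ.≤-trans (s≤s t<j) j<m))
    ... | tri> _ _ j<i = downward (λ t → u t ∈ₗ L) (ℕₚ.<⇒≤ j<i) c∈L
        λ t _ t<i ut+1∈L → closed (suc t) (ℕₚ.≤-trans (s≤s t<i) i<m) ut+1∈L
                             (Adj-sym G (u-adj t (ℕₚ.≤-trans (s≤s t<i) i<m)))

module _ {n : ℕ} (G : Graph n) where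

  nth : List (Fin n) → Fin n → ℕ → Fin n
  nth []       d _       = d
  nth (x ∷ l)  d zero    = x
  nth (x ∷ l)  d (suc i) = nth l d i

  private
    nth-adj : ∀ l d i → AdjChain G l → suc i < length l → Adj G (nth l d i) (nth l d (suc i))
    nth-adj (x ∷ [])    d _       _            (s≤s ())
    nth-adj (x ∷ y ∷ l) d zero    (xy , _)     _         = xy
    nth-adj (x ∷ y ∷ l) d (suc i) (_ , chain) (s≤s i+1<) = nth-adj (y ∷ l) d i chain i+1<

    nth-∈ : ∀ l d i → i < length l → nth l d i ∈ₗ l
    nth-∈ (x ∷ l) d zero    _         = Any.here refl
    nth-∈ (x ∷ l) d (suc i) (s≤s i<l) = Any.there (nth-∈ l d i i<l)

    nth-injective : ∀ l d i k → Unique l → i < length l → k < length l → nth l d i ≡ nth l d k → i ≡ k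
    nth-injective (x ∷ l) d zero    zero    _            _         _         _ = refl
    nth-injective (x ∷ l) d zero    (suc k) (x∉l ∷ _)    _         (s≤s k<l) e = ⊥-elim (All.lookup x∉l (nth-∈ l d k k<l) e)
    nth-injective (x ∷ l) d (suc i) zero    (x∉l ∷ _)    (s≤s i<l) _         e = ⊥-elim (All.lookup x∉l (nth-∈ l d i i<l) (sym e))
    nth-injective (x ∷ l) d (suc i) (suc k) (_ ∷ unique) (s≤s i<l) (s≤s k<l) e = cong suc (nth-injective l d i k unique i<l k<l e)

  toSubset⇒nth : ∀ l d {v} → v ∈ toSubset G l → ∃ λ i → i < length l × nth l d i ≡ v
  toSubset⇒nth []      d v∈ = ⊥-elim (∉⊥ v∈)
  toSubset⇒nth (x ∷ l) d v∈ with x∈p∪q⁻ ⁅ x ⁆ (toSubset G l) v∈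
  ... | inj₁ v∈⁅x⁆ = 0 , s≤s z≤n , sym (x∈⁅y⁆⇒x≡y x v∈⁅x⁆)
  ... | inj₂ v∈l with toSubset⇒nth l d v∈l
  ...   | i , i<l , e = suc i , s≤s i<l , e

  nth⇒toSubset : ∀ l d i → i < length l → nth l d i ∈ toSubset G l
  nth⇒toSubset (x ∷ l) d zero    _         = x∈p∪q⁺ (inj₁ (x∈⁅x⁆ x))
  nth⇒toSubset (x ∷ l) d (suc i) (s≤s i<l) = x∈p∪q⁺ (inj₂ (nth⇒toSubset l d i i<l))

  module _ (ps : List (Fin n)) (a b : Fin n) (N≡ : N G Full (toSubset G ps) ≡ ⁅ a ⁆ ∪ ⁅ b ⁆) where

    private
      ∈N⁻′ : ∀ {v} → v ∈ ⁅ a ⁆ ∪ ⁅ b ⁆ → v ∉ toSubset G ps × ∃ λ x → x ∈ toSubset G ps × Adj G x v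
      ∈N⁻′ v∈ = proj₂ (∈N⁻ G Full (toSubset G ps) (subst (_ ∈_) (sym N≡) v∈))

    a∉path : a ∉ toSubset G ps
    a∉path = proj₁ (∈N⁻′ (x∈p∪q⁺ (inj₁ (x∈⁅x⁆ a))))

    b∉path : b ∉ toSubset G ps
    b∉path = proj₁ (∈N⁻′ (x∈p∪q⁺ (inj₂ (x∈⁅x⁆ b))))

    degreeTwoPath : IsPath G ps → (∀ v → v ∈ toSubset G ps → deg G v ≡ 2) → DegreeTwoPath G
    degreeTwoPath (_ , unique , chain) deg≡2 = record
      { m = length ps ; u = nth ps a ; P = toSubset G ps
      ; u-adj = λ i → nth-adj ps a i chain
      ; u-injective = λ i k → nth-injective ps a i k unique
      ; deg≡2 = λ i i<m → deg≡2 _ (nth⇒toSubset ps a i i<m)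
      ; ∈P⇒index = toSubset⇒nth ps a
      ; index⇒∈P = nth⇒toSubset ps a
      ; a = a ; b = b
      ; a∉P = a∉path
      ; a-attached = a-attached
      ; exits = exits }
      where
      a-attached : ∃ λ i → i < length ps × Adj G (nth ps a i) a
      a-attached with ∈N⁻′ (x∈p∪q⁺ (inj₁ (x∈⁅x⁆ a)))
      ... | _ , x , x∈ , xa with toSubset⇒nth ps a x∈
      ...   | i , i<m , refl = i , i<m , xa
      exits : ∀ i v → i < length ps → Adj G (nth ps a i) v → v ∉ toSubset G ps → v ≡ a ⊎ v ≡ b
      exits i v i<m uv v∉P
        with x∈p∪q⁻ ⁅ a ⁆ ⁅ b ⁆ (subst (v ∈_) N≡ (∈N⁺ G ∈⊤ v∉P (nth⇒toSubset ps a i i<m) uv))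
      ... | inj₁ v∈⁅a⁆ = inj₁ (x∈⁅y⁆⇒x≡y a v∈⁅a⁆)
      ... | inj₂ v∈⁅b⁆ = inj₂ (x∈⁅y⁆⇒x≡y b v∈⁅b⁆)

module _ {n : ℕ} (G : Graph n) where

  private
    ∩-agree : ∀ {A B X : Subset n} → (∀ {v} → v ∈ X → v ∈ A → v ∈ B) → (∀ {v} → v ∈ X → v ∈ B → v ∈ A) →
      A ∩ X ≡ B ∩ X
    ∩-agree {A} {B} {X} A⇒B B⇒A = ⊆-antisym (into A⇒B) (into B⇒A)
      where
      into : ∀ {C D} → (∀ {v} → v ∈ X → v ∈ C → v ∈ D) → C ∩ X ⊆ D ∩ X
      into {C} C⇒D v∈ with x∈p∩q⁻ C X v∈
      ... | v∈C , v∈X = x∈p∩q⁺ (C⇒D v∈X v∈C , v∈X)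

  Transversal-∷⁺ : ∀ {𝒳 S x} → All (x ∉_) 𝒳 → Transversal G 𝒳 S → Transversal G (⁅ x ⁆ ∷ 𝒳) (S ∪ ⁅ x ⁆)
  Transversal-∷⁺ {𝒳} {S} {x} x∉𝒳 (covered , ∣S∩X∣≡1) =
    covered′ , trans (cong ∣_∣ S∪x∩x≡x) (∣⁅x⁆∣≡1 x) ∷ All.zipWith ∣∩∣≡1 (x∉𝒳 , ∣S∩X∣≡1)
    where
    covered′ : ∀ {v} → v ∈ S ∪ ⁅ x ⁆ → Any (v ∈_) (⁅ x ⁆ ∷ 𝒳)
    covered′ {v} v∈ with x∈p∪q⁻ S ⁅ x ⁆ v∈
    ... | inj₁ v∈S   = Any.there (covered v∈S)
    ... | inj₂ v∈⁅x⁆ = Any.here v∈⁅x⁆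
    S∪x∩x≡x : (S ∪ ⁅ x ⁆) ∩ ⁅ x ⁆ ≡ ⁅ x ⁆
    S∪x∩x≡x = ⊆-antisym (p∩q⊆q _ _) (λ v∈⁅x⁆ → x∈p∩q⁺ (x∈p∪q⁺ (inj₂ v∈⁅x⁆) , v∈⁅x⁆))
    ∣∩∣≡1 : ∀ {X} → x ∉ X × ∣ S ∩ X ∣ ≡ 1 → ∣ (S ∪ ⁅ x ⁆) ∩ X ∣ ≡ 1
    ∣∩∣≡1 {X} (x∉X , ∣S∩X∣≡1) = trans (cong ∣_∣ (∩-agree drop add)) ∣S∩X∣≡1
      where
      drop : ∀ {v} → v ∈ X → v ∈ S ∪ ⁅ x ⁆ → v ∈ S
      drop v∈X v∈ with x∈p∪q⁻ S ⁅ x ⁆ v∈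
      ... | inj₁ v∈S   = v∈S
      ... | inj₂ v∈⁅x⁆ = ⊥-elim (x∉X (subst (_∈ X) (x∈⁅y⁆⇒x≡y x v∈⁅x⁆) v∈X))
      add : ∀ {v} → v ∈ X → v ∈ S → v ∈ S ∪ ⁅ x ⁆
      add _ v∈S = x∈p∪q⁺ (inj₁ v∈S)

  Transversal-∷⁻ : ∀ {𝒳 S x} → All (x ∉_) 𝒳 → Transversal G (⁅ x ⁆ ∷ 𝒳) S → x ∈ S × Transversal G 𝒳 (S - x)
  Transversal-∷⁻ {𝒳} {S} {x} x∉𝒳 (covered , ∣S∩x∣≡1 ∷ ∣S∩X∣≡1) =
    ∣p∩⁅x⁆∣≡1⇒x∈p ∣S∩x∣≡1 , covered′ , All.zipWith ∣∩∣≡1 (x∉𝒳 , ∣S∩X∣≡1)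
    where
    covered′ : ∀ {v} → v ∈ S - x → Any (v ∈_) 𝒳
    covered′ v∈ with x∈p─q⁻ v∈
    ... | v∈S , v∉⁅x⁆ with covered v∈S
    ...   | Any.here v∈⁅x⁆ = ⊥-elim (v∉⁅x⁆ v∈⁅x⁆)
    ...   | Any.there v∈𝒳  = v∈𝒳
    ∣∩∣≡1 : ∀ {X} → x ∉ X × ∣ S ∩ X ∣ ≡ 1 → ∣ (S - x) ∩ X ∣ ≡ 1
    ∣∩∣≡1 {X} (x∉X , ∣S∩X∣≡1) = trans (cong ∣_∣ (∩-agree (λ _ → proj₁ ∘ x∈p─q⁻) add)) ∣S∩X∣≡1
      where
      add : ∀ {v} → v ∈ X → v ∈ S → v ∈ S - x
      add v∈X v∈S = x∈p∧x≢y⇒x∈p-y v∈S (λ { refl → x∉X v∈X })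

-- Replacing the path by its vertices other than p

module Splice {n : ℕ} {G : Graph n} (path : DegreeTwoPath G) (j : ℕ) (j<m : j < DegreeTwoPath.m path)
  (k : ℕ) (F : Subset n) (w : Fin n → ℕ)
  (a∈F : DegreeTwoPath.a path ∈ F) (b∈F : DegreeTwoPath.b path ∈ F)
  (b∉P : DegreeTwoPath.b path ∉ DegreeTwoPath.P path) (p∉F : DegreeTwoPath.u path j ∉ F) where

  open DegreeTwoPath path
  open DegreeTwoPathProperties path
  open Cut path j j<m

  U : Subset n
  U = ∁ P

  Candidate : Subset n → Set
  Candidate H = 𝒮 G Full k F H × p ∈ N G Full H

  Inner : Subset n → Set
  Inner = 𝒮 G U (k ∸ 1) (F ─ P)

  Q⊆P : Q ⊆ P
  Q⊆P = proj₁ ∘ Q⁻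

  F⊆∪Q : ∀ {H} → F ─ P ⊆ H → F ⊆ H ∪ Q
  F⊆∪Q F─P⊆H {v} v∈F with v ∈? P
  ... | no v∉P  = x∈p∪q⁺ (inj₁ (F─P⊆H (x∈p∧x∉q⇒x∈p─q v∈F v∉P)))
  ... | yes v∈P = x∈p∪q⁺ (inj₂ (x∈p∧x≢y⇒x∈p-y v∈P (λ { refl → p∉F v∈F })))

  ⊆∩U∪Q : ∀ {H} → p ∉ H → H ⊆ (H ∩ U) ∪ Q
  ⊆∩U∪Q p∉H {v} v∈H with v ∈? P
  ... | no v∉P  = x∈p∪q⁺ (inj₁ (x∈p∩q⁺ (v∈H , x∉p⇒x∈∁p v∉P)))
  ... | yes v∈P = x∈p∪q⁺ (inj₂ (x∈p∧x≢y⇒x∈p-y v∈P (λ { refl → p∉H v∈H })))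

  wt-restrict : ∀ {H} → p ∉ H → wt w H ≤ wt w (H ∩ U) + wt w Q
  wt-restrict {H} p∉H = ℕₚ.≤-trans (wt-mono w (⊆∩U∪Q p∉H)) (wt-∪ w (H ∩ U) Q)

  wt-extend : ∀ {H′} → H′ ⊆ U → wt w (H′ ∪ Q) ≡ wt w H′ + wt w Q
  wt-extend {H′} H′⊆U = wt-∪-disjoint w H′ Q disjoint
    where
    disjoint : Empty (H′ ∩ Q)
    disjoint (v , v∈) with x∈p∩q⁻ H′ Q v∈
    ... | v∈H′ , v∈Q = x∈∁p⇒x∉p (H′⊆U v∈H′) (Q⊆P v∈Q)

  ∣N∣-restrict : ∀ {S} → p ∈ S → ∣ S ∣ ≤ k → ∣ S - p ∣ ≤ k ∸ 1
  ∣N∣-restrict {S} p∈S ∣S∣≤k =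
    ℕₚ.m+n≤o⇒m≤o∸n ∣ S - p ∣ (ℕₚ.≤-trans (ℕₚ.≤-reflexive (trans (ℕₚ.+-comm ∣ S - p ∣ 1) (x∈p⇒suc∣p-x∣≡∣p∣ S p∈S))) ∣S∣≤k)

  N-restrict⊆ : ∀ H → N G U (H ∩ U) ⊆ N G Full H - p
  N-restrict⊆ H v∈ with ∈N⁻ G U (H ∩ U) v∈
  ... | v∈U , v∉H∩U , z , z∈H∩U , zv =
    x∈p∧x≢y⇒x∈p-y (∈N⁺ G ∈⊤ (λ v∈H → v∉H∩U (x∈p∩q⁺ (v∈H , v∈U))) (p∩q⊆p H U z∈H∩U) zv)
                  (λ { refl → x∈∁p⇒x∉p v∈U p∈P })

  restrict : ∀ {H} → Candidate H → Inner (H ∩ U)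
  restrict {H} ((((_ , (_ , connected , acyclic) , ∣N∣≤k) , F⊆H)) , p∈N) =
    (p∩q⊆q H U ,
     ((a , x∈p∩q⁺ (F⊆H a∈F , x∉p⇒x∈∁p a∉P)) , connected-∖P (N-∉ G Full H p∈N) connected ,
      Acyclic-mono G (p∩q⊆p H U) acyclic) ,
     ℕₚ.≤-trans (p⊆q⇒∣p∣≤∣q∣ (N-restrict⊆ H)) (∣N∣-restrict p∈N ∣N∣≤k)) ,
    λ v∈F─P → let (v∈F , v∉P) = x∈p─q⁻ v∈F─P in x∈p∩q⁺ (F⊆H v∈F , x∉p⇒x∈∁p v∉P)

  p-neighbour : ∃ λ z → (z ∈ Q ⊎ z ≡ a ⊎ z ≡ b) × Adj G z p
  p-neighbour with deg≡2⇒neighbour G (deg≡2 j j<m)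
  ... | z , pz with z ∈? P
  ... | yes z∈P = z , inj₁ (x∈p∧x≢y⇒x∈p-y z∈P (Adj-irrefl G pz ∘ sym)) , Adj-sym G pz
  ... | no z∉P  = z , inj₂ (exits j z j<m pz z∉P) , Adj-sym G pz

  N-extend : ∀ {H′} → H′ ⊆ U → a ∈ H′ → b ∈ H′ → N G Full (H′ ∪ Q) ≡ N G U H′ ∪ ⁅ p ⁆
  N-extend {H′} H′⊆U a∈H′ b∈H′ = ⊆-antisym shrink grow
    where
    p∉H′∪Q : p ∉ H′ ∪ Q
    p∉H′∪Q p∈ with x∈p∪q⁻ H′ Q p∈
    ... | inj₁ p∈H′ = x∈∁p⇒x∉p (H′⊆U p∈H′) p∈P
    ... | inj₂ p∈Q  = p∉Q p∈Q
    shrink : N G Full (H′ ∪ Q) ⊆ N G U H′ ∪ ⁅ p ⁆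
    shrink {v} v∈ with ∈N⁻ G Full (H′ ∪ Q) v∈
    ... | _ , v∉H′∪Q , z , z∈H′∪Q , zv with v ∈? P
    ...   | yes v∈P with v ≟ p
    ...     | yes refl = x∈p∪q⁺ (inj₂ (x∈⁅x⁆ p))
    ...     | no v≢p   = ⊥-elim (v∉H′∪Q (x∈p∪q⁺ (inj₂ (x∈p∧x≢y⇒x∈p-y v∈P v≢p))))
    shrink {v} v∈ | _ , v∉H′∪Q , z , z∈H′∪Q , zv | no v∉P with x∈p∪q⁻ H′ Q z∈H′∪Q
    ... | inj₁ z∈H′ = x∈p∪q⁺ (inj₁ (∈N⁺ G (x∉p⇒x∈∁p v∉P) (v∉H′∪Q ∘ x∈p∪q⁺ ∘ inj₁) z∈H′ zv))
    ... | inj₂ z∈Q with ∈P⇒index (Q⊆P z∈Q)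
    ...   | i , i<m , refl with exits i v i<m zv v∉P
    ...     | inj₁ refl = ⊥-elim (v∉H′∪Q (x∈p∪q⁺ (inj₁ a∈H′)))
    ...     | inj₂ refl = ⊥-elim (v∉H′∪Q (x∈p∪q⁺ (inj₁ b∈H′)))
    grow : N G U H′ ∪ ⁅ p ⁆ ⊆ N G Full (H′ ∪ Q)
    grow {v} v∈ with x∈p∪q⁻ (N G U H′) ⁅ p ⁆ v∈
    ... | inj₂ v∈⁅p⁆ rewrite x∈⁅y⁆⇒x≡y p v∈⁅p⁆ with p-neighbour
    ...   | z , z∈ , zp = ∈N⁺ G ∈⊤ p∉H′∪Q (neighbour∈ z∈) zp
      where
      neighbour∈ : ∀ {z} → z ∈ Q ⊎ z ≡ a ⊎ z ≡ b → z ∈ H′ ∪ Q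
      neighbour∈ (inj₁ z∈Q)         = x∈p∪q⁺ (inj₂ z∈Q)
      neighbour∈ (inj₂ (inj₁ refl)) = x∈p∪q⁺ (inj₁ a∈H′)
      neighbour∈ (inj₂ (inj₂ refl)) = x∈p∪q⁺ (inj₁ b∈H′)
    grow {v} v∈ | inj₁ v∈N with ∈N⁻ G U H′ v∈N
    ... | v∈U , v∉H′ , z , z∈H′ , zv = ∈N⁺ G ∈⊤ v∉H′∪Q (x∈p∪q⁺ (inj₁ z∈H′)) zv
      where
      v∉H′∪Q : v ∉ H′ ∪ Q
      v∉H′∪Q v∈′ with x∈p∪q⁻ H′ Q v∈′
      ... | inj₁ v∈H′ = v∉H′ v∈H′
      ... | inj₂ v∈Q  = x∈∁p⇒x∉p v∈U (Q⊆P v∈Q)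

  extend : ∀ {H′} → 1 ≤ k → Inner H′ → Candidate (H′ ∪ Q)
  extend {H′} 1≤k ((H′⊆U , (_ , connected , acyclic) , ∣N∣≤k∸1) , F─P⊆H′) =
    ((⊆⊤ , ((a , H′⊆W a∈H′) , connected′ , acyclic-∪Q (x∈∁p⇒x∉p ∘ H′⊆U) acyclic) , ∣N∣≤k) ,
     F⊆∪Q F─P⊆H′) ,
    subst (p ∈_) (sym N≡) (x∈p∪q⁺ (inj₂ (x∈⁅x⁆ p)))
    where
    W : Subset n
    W = H′ ∪ Q
    H′⊆W : H′ ⊆ W
    H′⊆W = x∈p∪q⁺ ∘ inj₁
    a∈H′ : a ∈ H′
    a∈H′ = F─P⊆H′ (x∈p∧x∉q⇒x∈p─q a∈F a∉P)
    b∈H′ : b ∈ H′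
    b∈H′ = F─P⊆H′ (x∈p∧x∉q⇒x∈p─q b∈F b∉P)
    N≡ : N G Full W ≡ N G U H′ ∪ ⁅ p ⁆
    N≡ = N-extend H′⊆U a∈H′ b∈H′
    ⇝a : ∀ {z} → z ∈ W → Reach G W z a
    ⇝a {z} z∈W with x∈p∪q⁻ H′ Q z∈W
    ... | inj₁ z∈H′ = Reach-mono G H′⊆W (connected z a z∈H′ a∈H′)
    ... | inj₂ z∈Q with Q-reachable (x∈p∪q⁺ ∘ inj₂) (H′⊆W a∈H′) (H′⊆W b∈H′) z∈Q
    ...   | inj₁ a⇝z = Reach-sym G a⇝z
    ...   | inj₂ b⇝z = Reach-trans G (Reach-sym G b⇝z) (Reach-mono G H′⊆W (connected b a b∈H′ a∈H′))
    connected′ : Connected G W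
    connected′ x y x∈W y∈W = Reach-trans G (⇝a x∈W) (Reach-sym G (⇝a y∈W))
    ∣N∣≤k : ∣ N G Full W ∣ ≤ k
    ∣N∣≤k = begin
      ∣ N G Full W ∣               ≡⟨ cong ∣_∣ N≡ ⟩
      ∣ N G U H′ ∪ ⁅ p ⁆ ∣         ≤⟨ ∣p∪q∣≤∣p∣+∣q∣ (N G U H′) ⁅ p ⁆ ⟩
      ∣ N G U H′ ∣ + ∣ ⁅ p ⁆ ∣     ≤⟨ ℕₚ.+-mono-≤ ∣N∣≤k∸1 (ℕₚ.≤-reflexive (∣⁅x⁆∣≡1 p)) ⟩
      k ∸ 1 + 1                    ≡⟨ ℕₚ.m∸n+n≡m 1≤k ⟩
      k                            ∎
      where open ℕₚ.≤-Reasoning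

  Candidate⇒1≤k : ∀ {H} → Candidate H → 1 ≤ k
  Candidate⇒1≤k ((((_ , _ , ∣N∣≤k)) , _) , p∈N) = ℕₚ.≤-trans (x∈p⇒∣p∣>0 p∈N) ∣N∣≤k

  -- A heaviest candidate contains Q: otherwise restricting it to G - P and adding Q back
  -- would give a heavier one.
  maximal⇒Q⊆ : (∀ v → 1 ≤ w v) → ∀ {H} → Max w Candidate H → Q ⊆ H
  maximal⇒Q⊆ w>0 {H} (candidate , maximal) {q} q∈Q with q ∈? H
  ... | yes q∈H = q∈H
  ... | no q∉H  = ⊥-elim (ℕₚ.<-irrefl refl (begin-strict
    wt w H                          ≤⟨ wt-mono w H⊆ ⟩
    wt w (H ∩ U ∪ (Q - q))          ≤⟨ wt-∪ w (H ∩ U) (Q - q) ⟩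
    wt w (H ∩ U) + wt w (Q - q)     <⟨ ℕₚ.+-monoʳ-< (wt w (H ∩ U)) (wt-<-remove w w>0 Q q∈Q) ⟩
    wt w (H ∩ U) + wt w Q           ≡⟨ wt-extend (p∩q⊆q H U) ⟨
    wt w (H ∩ U ∪ Q)                ≤⟨ maximal _ (extend (Candidate⇒1≤k candidate) (restrict candidate)) ⟩
    wt w H                          ∎))
    where
    open ℕₚ.≤-Reasoning
    H⊆ : H ⊆ H ∩ U ∪ (Q - q)
    H⊆ {v} v∈H with x∈p∪q⁻ (H ∩ U) Q (⊆∩U∪Q (N-∉ G Full H (proj₂ candidate)) v∈H)
    ... | inj₁ v∈H∩U = x∈p∪q⁺ (inj₁ v∈H∩U)
    ... | inj₂ v∈Q   = x∈p∪q⁺ (inj₂ (x∈p∧x≢y⇒x∈p-y v∈Q (λ { refl → q∉H v∈H })))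

  ∩U∪Q≡ : ∀ {H} → p ∉ H → Q ⊆ H → H ∩ U ∪ Q ≡ H
  ∩U∪Q≡ {H} p∉H Q⊆H = ⊆-antisym ∪⊆ (⊆∩U∪Q p∉H)
    where
    ∪⊆ : H ∩ U ∪ Q ⊆ H
    ∪⊆ v∈ with x∈p∪q⁻ (H ∩ U) Q v∈
    ... | inj₁ v∈H∩U = p∩q⊆p H U v∈H∩U
    ... | inj₂ v∈Q   = Q⊆H v∈Q

  restrict-maximal : ∀ {H} → Max w Candidate H → Q ⊆ H → Max w Inner (H ∩ U)
  restrict-maximal {H} (candidate , maximal) Q⊆H = restrict candidate , λ H₂ inner → ℕₚ.+-cancelʳ-≤ (wt w Q) _ _ (begin
    wt w H₂ + wt w Q         ≡⟨ wt-extend (proj₁ (proj₁ inner)) ⟨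
    wt w (H₂ ∪ Q)            ≤⟨ maximal _ (extend (Candidate⇒1≤k candidate) inner) ⟩
    wt w H                   ≤⟨ wt-restrict (N-∉ G Full H (proj₂ candidate)) ⟩
    wt w (H ∩ U) + wt w Q    ∎)
    where open ℕₚ.≤-Reasoning

  restriction-component : ∀ {H r} → p ∉ H → Connected G H → r ∈ H → r ∈ U →
    IsComponent G (U ─ (N G Full H - p)) r (H ∩ U)
  restriction-component {H} p∉H connected r∈H r∈U =
    x∈p∩q⁺ (r∈H , r∈U) , ⊆U─S , connected-∖P p∉H connected , no-neighbours
    where
    S : Subset n
    S = N G Full H - p
    ⊆U─S : H ∩ U ⊆ U ─ S
    ⊆U─S v∈ with x∈p∩q⁻ H U v∈
    ... | v∈H , v∈U = x∈p∧x∉q⇒x∈p─q v∈U (λ v∈S → N-∉ G Full H (proj₁ (x∈p─q⁻ v∈S)) v∈H)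
    no-neighbours : Empty (N G (U ─ S) (H ∩ U))
    no-neighbours (v , v∈) with ∈N⁻ G (U ─ S) (H ∩ U) v∈
    ... | v∈U─S , v∉H∩U , z , z∈H∩U , zv with x∈p─q⁻ v∈U─S
    ...   | v∈U , v∉S = v∉S (x∈p∧x≢y⇒x∈p-y v∈N (λ { refl → x∈∁p⇒x∉p v∈U p∈P }))
      where
      v∈N : v ∈ N G Full H
      v∈N = ∈N⁺ G ∈⊤ (λ v∈H → v∉H∩U (x∈p∩q⁺ (v∈H , v∈U))) (p∩q⊆p H U z∈H∩U) zv

  Q⊆-of-ends : ∀ {H} → a ∈ H → b ∈ H → (∀ {v} → v ∈ N G Full H → v ∈ P → v ≡ p) → Q ⊆ H
  Q⊆-of-ends {H} a∈H b∈H N∩P⊆⁅p⁆ q∈Q =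
    [ stay a∈H , stay b∈H ]′ (Q-reachable (x∈p∪q⁺ ∘ inj₂) (x∈p∪q⁺ (inj₁ a∈H)) (x∈p∪q⁺ (inj₁ b∈H)) q∈Q)
    where
    H∪Q∩N=∅ : ∀ {v} → v ∈ H ∪ Q → v ∉ N G Full H
    H∪Q∩N=∅ {v} v∈ v∈N with x∈p∪q⁻ H Q v∈
    ... | inj₁ v∈H = N-∉ G Full H v∈N v∈H
    ... | inj₂ v∈Q with N∩P⊆⁅p⁆ v∈N (Q⊆P v∈Q)
    ...   | refl = p∉Q v∈Q
    stay : ∀ {x y} → x ∈ H → Reach G (H ∪ Q) x y → y ∈ H
    stay x∈H x⇝y = Reach-stays-in G H∪Q∩N=∅ x⇝y x∈H

  extendDescr : Descr G → Descr G
  extendDescr d = proj₁ d , ⁅ p ⁆ ∷ proj₂ d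

  module _ (𝔛 : List (Descr G)) (descriptions : All (IsDescription G U) 𝔛)
           (𝔛-describes : 𝒯 G U (k ∸ 1) 𝔛 ≐ Max w Inner) where

    private
      p∉parts : ∀ {d} → IsDescription G U d → All (p ∉_) (proj₂ d)
      p∉parts (_ , parts⊆U , _) = All.map (λ (X⊆U , _) p∈X → x∈∁p⇒x∉p (X⊆U p∈X) p∈P) parts⊆U

    describedBy-extend : ∀ {d H′ H} → IsDescription G U d → DescribedBy G U d H′ → H′ ⊆ H →
      N G Full H ≡ N G U H′ ∪ ⁅ p ⁆ → DescribedBy G Full (extendDescr d) H
    describedBy-extend desc (r∈H′ , transversal) H′⊆H N≡ =
      H′⊆H r∈H′ , subst (Transversal G _) (sym N≡) (Transversal-∷⁺ G (p∉parts desc) transversal)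

    describedBy-restrict : ∀ {d H} → IsDescription G U d → Connected G H → DescribedBy G Full (extendDescr d) H →
      p ∈ N G Full H × DescribedBy G U d (H ∩ U) × N G U (H ∩ U) ≡ N G Full H - p
    describedBy-restrict {d} {H} desc@(r∈U , _ , _ , components) connected (r∈H , transversal)
      with Transversal-∷⁻ G (p∉parts desc) transversal
    ... | p∈N , transversal′ =
      p∈N , (x∈p∩q⁺ (r∈H , r∈U) , subst (Transversal G (proj₂ d)) (sym N≡) transversal′) , N≡
      where
      N≡ : N G U (H ∩ U) ≡ N G Full H - p
      N≡ = proj₂ (components _ transversal′ (H ∩ U)
                   (restriction-component (N-∉ G Full H p∈N) connected r∈H r∈U))

    maximal⇒described : (∀ v → 1 ≤ w v) → ∀ H → Max w Candidate H → 𝒯 G Full k (map extendDescr 𝔛) H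
    maximal⇒described w>0 H max@(candidate@((secluded , _) , p∈N) , _)
      with find (proj₂ (Equivalence.from (𝔛-describes (H ∩ U)) (restrict-maximal max (maximal⇒Q⊆ w>0 max))))
    ... | d , d∈𝔛 , described =
      secluded , Anyₚ.map⁺ (lose d∈𝔛 (describedBy-extend (All.lookup descriptions d∈𝔛) described (p∩q⊆p H U) N≡))
      where
      Q⊆H : Q ⊆ H
      Q⊆H = maximal⇒Q⊆ w>0 max
      F─P⊆H∩U : F ─ P ⊆ H ∩ U
      F─P⊆H∩U = proj₂ (restrict candidate)
      N≡ : N G Full H ≡ N G U (H ∩ U) ∪ ⁅ p ⁆
      N≡ = trans (cong (N G Full) (sym (∩U∪Q≡ (N-∉ G Full H p∈N) Q⊆H)))
                 (N-extend (p∩q⊆q H U) (F─P⊆H∩U (x∈p∧x∉q⇒x∈p─q a∈F a∉P)) (F─P⊆H∩U (x∈p∧x∉q⇒x∈p─q b∈F b∉P)))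

    described⇒maximal : ∀ H → 𝒯 G Full k (map extendDescr 𝔛) H → Max w Candidate H
    described⇒maximal H (secluded@(_ , (_ , connected , acyclic) , ∣N∣≤k) , described)
      with find (Anyₚ.map⁻ described)
    ... | d , d∈𝔛 , described-d
      with describedBy-restrict (All.lookup descriptions d∈𝔛) connected described-d
    ... | p∈N , described-C , N≡ = ((secluded , F⊆H) , p∈N) , heaviest
      where
      C : Subset n
      C = H ∩ U
      p∉H : p ∉ H
      p∉H = N-∉ G Full H p∈N
      C-max : Max w Inner C
      C-max = Equivalence.to (𝔛-describes C)
        ((p∩q⊆q H U , ((_ , proj₁ described-C) , connected-∖P p∉H connected , Acyclic-mono G (p∩q⊆p H U) acyclic) ,
          subst (λ S → ∣ S ∣ ≤ k ∸ 1) (sym N≡) (∣N∣-restrict p∈N ∣N∣≤k)) ,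
         lose d∈𝔛 described-C)
      end∈H : ∀ {v} → v ∈ F → v ∉ P → v ∈ H
      end∈H v∈F v∉P = p∩q⊆p H U (proj₂ (proj₁ C-max) (x∈p∧x∉q⇒x∈p─q v∈F v∉P))
      N∩P⊆⁅p⁆ : ∀ {v} → v ∈ N G Full H → v ∈ P → v ≡ p
      N∩P⊆⁅p⁆ {v} v∈N v∈P with v ≟ p
      ... | yes v≡p = v≡p
      ... | no v≢p  = ⊥-elim (x∈∁p⇒x∉p (proj₁ (∈N⁻ G U C (subst (v ∈_) (sym N≡) (x∈p∧x≢y⇒x∈p-y v∈N v≢p)))) v∈P)
      Q⊆H : Q ⊆ H
      Q⊆H = Q⊆-of-ends (end∈H a∈F a∉P) (end∈H b∈F b∉P) N∩P⊆⁅p⁆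
      F⊆H : F ⊆ H
      F⊆H = subst (F ⊆_) (∩U∪Q≡ p∉H Q⊆H) (F⊆∪Q (proj₂ (proj₁ C-max)))
      heaviest : ∀ H₂ → Candidate H₂ → wt w H₂ ≤ wt w H
      heaviest H₂ candidate = begin
        wt w H₂                   ≤⟨ wt-restrict (N-∉ G Full H₂ (proj₂ candidate)) ⟩
        wt w (H₂ ∩ U) + wt w Q    ≤⟨ ℕₚ.+-monoˡ-≤ (wt w Q) (proj₂ C-max _ (restrict candidate)) ⟩
        wt w C + wt w Q           ≡⟨ wt-extend (p∩q⊆q H U) ⟨
        wt w (C ∪ Q)              ≡⟨ cong (wt w) (∩U∪Q≡ p∉H Q⊆H) ⟩
        wt w H                    ∎
        where open ℕₚ.≤-Reasoning

lemma4 : ∀ {n} (G : Graph n) (k : ℕ) (F T : Subset n) (w : Fin n → ℕ) →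
    ELSS G k F T w →
    (ps : List (Fin n)) → IsPath G ps →
    (∀ v → v ∈ toSubset G ps → deg G v ≡ 2) →
    (a b : Fin n) → a ∈ F → b ∈ F →
    N G Full (toSubset G ps) ≡ ⁅ a ⁆ ∪ ⁅ b ⁆ →
    (𝔛 : List (Descr G)) →
    All (IsDescription G (∁ (toSubset G ps))) 𝔛 →
    (𝒯 G (∁ (toSubset G ps)) (k ∸ 1) 𝔛
      ≐ Max w (𝒮 G (∁ (toSubset G ps)) (k ∸ 1) (F ─ toSubset G ps))) →
    ∀ p → p ∈ toSubset G ps → p ∉ F →
    (𝒯 G Full k (map (λ d → proj₁ d , ⁅ p ⁆ ∷ proj₂ d) 𝔛)
      ≐ Max w (λ H → 𝒮 G Full k F H × p ∈ N G Full H))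
lemma4 G k F T w (_ , _ , _ , w>0) ps isPath deg≡2 a b a∈F b∈F N≡ 𝔛 descriptions 𝔛-describes p p∈ps p∉F
  with toSubset⇒nth G ps a p∈ps
... | j , j<m , refl = λ H →
  mk⇔ (described⇒maximal 𝔛 descriptions 𝔛-describes H) (maximal⇒described 𝔛 descriptions 𝔛-describes w>0 H)
  where
  open Splice (degreeTwoPath G ps a b N≡ isPath deg≡2) j j<m k F w a∈F b∈F (b∉path G ps a b N≡) p∉F
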